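{- For any positive integer $k$, put $p(k)=324k^4 -216k^3 +84k^2 -16k-1$. Then for every integer $k \geq 2$, \begin{equation*} \frac{1}{p(k)+0.9}-\frac{1}{p(k+1)+0.9}< \frac{1}{(3k)^5}+\frac{1}{(3k+1)^5}+\frac{1}{(3k+2)^5}<\frac{1}{p(k)}-\frac{1}{p(k+1)}. \end{equation*} -}

module Defs where

open import Data.Nat using (ℕ; zero; suc)
open import Data.Integer using (+_)
open import Data.Rational using (ℚ; _/_; _+_; _-_; _*_; 0ℚ; 1ℚ; 1/_; NonZero; ≢-nonZero)
open import Data.Rational.Properties using (_≟_)
open import Relation.Nullary using (yes; no)

ℕ→ℚ : ℕ → ℚ
ℕ→ℚ n = + n / 1

_^ℚ_ : ℚ → ℕ → ℚ
q ^ℚ zero = 1ℚ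
q ^ℚ suc n = q * (q ^ℚ n)

-- reciprocal 1/q; totalised by 1/0 := 0 (never used at 0 in the statement)
inv : ℚ → ℚ
inv q with q ≟ 0ℚ
... | yes _ = 0ℚ
... | no q≢0 = 1/_ q {{≢-nonZero q≢0}}

p : ℕ → ℚ
p k = ((((ℕ→ℚ 324 * (K ^ℚ 4)) - (ℕ→ℚ 216 * (K ^ℚ 3))) + (ℕ→ℚ 84 * (K ^ℚ 2))) - (ℕ→ℚ 16 * K)) - 1ℚ
  where K = ℕ→ℚ k

nine-tenths : ℚ
nine-tenths = + 9 / 10

-- With k = 2 + m, clearing the denominators of 1/(p k + c/10) − 1/(p (k+1) + c/10) and of
-- Σⱼ 1/(3k+j)⁵ turns both bounds (c = 9 on the left, c = 0 on the right) into an inequality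
-- between two polynomials in m with natural coefficients, since 10 p (2 + m) + c has natural
-- coefficients.  Each of these holds for every m because, coefficient by coefficient, the
-- smaller side plus 1 is dominated by the larger one, which is checked by computation.

module Submission where

open import Defs
open import Algebra.Properties.AbelianGroup using (xyx⁻¹≈y)
open import Algebra.Properties.Group using (//-rightDividesʳ)
open import Data.Bool using (Bool; true; T; _∧_)
open import Data.Bool.Properties using (T-∧)
open import Data.Integer as ℤ using (+_)
import Data.Integer.Properties as ℤ
open import Data.List using (List; []; _∷_; map)
open import Data.Nat using (ℕ; suc; _≤_; z≤n; s≤s; z<s)
import Data.Nat as ℕ
import Data.Nat.Properties as ℕ
open import Data.Nat.Tactic.RingSolver using (solve-∀)
open import Data.Product using (_×_; _,_)
open import Data.Rational as ℚ using (ℚ; _+_; _*_; _-_; -_; _<_; 0ℚ; 1ℚ; Positive; positive; toℚᵘ)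
open import Data.Rational.Properties as ℚ using (toℚᵘ-injective; toℚᵘ-fromℚᵘ; toℚᵘ-homo-+; toℚᵘ-homo-*; toℚᵘ-cancel-<)
open import Data.Rational.Solver using (module +-*-Solver)
open import Data.Rational.Unnormalised as ℚᵘ using (ℚᵘ; mkℚᵘ; *≡*; _≃_)
import Data.Rational.Unnormalised.Properties as ℚᵘ
open import Function using (id; Equivalence)
open import Relation.Binary.PropositionalEquality using (_≡_; refl; sym; trans; cong; cong₂; subst; subst₂; module ≡-Reasoning)
open import Relation.Nullary using (yes; no; contradiction)

record RawArith (A : Set) : Set where
  infixl 6 _⊕_
  infixl 7 _⊗_
  field
    fromℕ   : ℕ → A
    _⊕_ _⊗_ : A → A → A

-- Evaluating the same expression in ℕ, in ℚ and in ℕ[x] is how an inequality is moved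
-- between these three carriers.
infixl 6 _+ₑ_
infixl 7 _*ₑ_

data Expr : Set where
  var       : Expr
  lit       : ℕ → Expr
  _+ₑ_ _*ₑ_ : Expr → Expr → Expr

Expr-arith : RawArith Expr
Expr-arith = record { fromℕ = lit ; _⊕_ = _+ₑ_ ; _⊗_ = _*ₑ_ }

ℕ-arith : RawArith ℕ
ℕ-arith = record { fromℕ = id ; _⊕_ = ℕ._+_ ; _⊗_ = ℕ._*_ }

eval : {A : Set} → RawArith A → Expr → A → A
eval O var      x = x
eval O (lit n)  x = RawArith.fromℕ O n
eval O (e +ₑ f) x = RawArith._⊕_ O (eval O e x) (eval O f x)
eval O (e *ₑ f) x = RawArith._⊗_ O (eval O e x) (eval O f x)

record IsHomomorphism {A B : Set} (O : RawArith A) (O′ : RawArith B) (h : A → B) : Set where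
  open RawArith O
  open RawArith O′ renaming (fromℕ to fromℕ′; _⊕_ to _⊕′_; _⊗_ to _⊗′_)
  field
    fromℕ-homo : ∀ n → h (fromℕ n) ≡ fromℕ′ n
    ⊕-homo     : ∀ x y → h (x ⊕ y) ≡ h x ⊕′ h y
    ⊗-homo     : ∀ x y → h (x ⊗ y) ≡ h x ⊗′ h y

eval-homo : ∀ {A B} {O : RawArith A} {O′ : RawArith B} {h : A → B} →
            IsHomomorphism O O′ h → ∀ e x → h (eval O e x) ≡ eval O′ e (h x)
eval-homo H var      x = refl
eval-homo H (lit n)  x = IsHomomorphism.fromℕ-homo H n
eval-homo {O′ = O′} H (e +ₑ f) x =
  trans (IsHomomorphism.⊕-homo H _ _) (cong₂ (RawArith._⊕_ O′) (eval-homo H e x) (eval-homo H f x))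
eval-homo {O′ = O′} H (e *ₑ f) x =
  trans (IsHomomorphism.⊗-homo H _ _) (cong₂ (RawArith._⊗_ O′) (eval-homo H e x) (eval-homo H f x))

-- Polynomials with natural coefficients, listed from the constant term up.
Poly : Set
Poly = List ℕ

module _ {A : Set} (O : RawArith A) where
  open RawArith O

  horner : Poly → A → A
  horner []       x = fromℕ 0
  horner (c ∷ cs) x = fromℕ c ⊕ x ⊗ horner cs x

  pow : ℕ → A → A
  pow ℕ.zero  x = fromℕ 1
  pow (suc n) x = x ⊗ pow n x

infixl 6 _+ₚ_
infixl 7 _*ₚ_

_+ₚ_ : Poly → Poly → Poly
[]      +ₚ q       = q
(a ∷ p) +ₚ []      = a ∷ p
(a ∷ p) +ₚ (b ∷ q) = a ℕ.+ b ∷ p +ₚ q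

_*ₚ_ : Poly → Poly → Poly
[]      *ₚ q = []
(a ∷ p) *ₚ q = map (a ℕ.*_) q +ₚ (0 ∷ p *ₚ q)

Poly-arith : RawArith Poly
Poly-arith = record { fromℕ = _∷ [] ; _⊕_ = _+ₚ_ ; _⊗_ = _*ₚ_ }

X : Poly
X = 0 ∷ 1 ∷ []

⟦_⟧ : Poly → ℕ → ℕ
⟦_⟧ = horner ℕ-arith

⟦+ₚ⟧ : ∀ p q m → ⟦ p +ₚ q ⟧ m ≡ ⟦ p ⟧ m ℕ.+ ⟦ q ⟧ m
⟦+ₚ⟧ []      q       m = refl
⟦+ₚ⟧ (a ∷ p) []      m = sym (ℕ.+-identityʳ _)
⟦+ₚ⟧ (a ∷ p) (b ∷ q) m = begin
  a ℕ.+ b ℕ.+ m ℕ.* ⟦ p +ₚ q ⟧ m                  ≡⟨ cong (λ t → a ℕ.+ b ℕ.+ m ℕ.* t) (⟦+ₚ⟧ p q m) ⟩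
  a ℕ.+ b ℕ.+ m ℕ.* (⟦ p ⟧ m ℕ.+ ⟦ q ⟧ m)         ≡⟨ regroup a b m (⟦ p ⟧ m) (⟦ q ⟧ m) ⟩
  a ℕ.+ m ℕ.* ⟦ p ⟧ m ℕ.+ (b ℕ.+ m ℕ.* ⟦ q ⟧ m)   ∎
  where
  open ≡-Reasoning
  regroup : ∀ a b m x y → a ℕ.+ b ℕ.+ m ℕ.* (x ℕ.+ y) ≡ a ℕ.+ m ℕ.* x ℕ.+ (b ℕ.+ m ℕ.* y)
  regroup = solve-∀

⟦map⟧ : ∀ a q m → ⟦ map (a ℕ.*_) q ⟧ m ≡ a ℕ.* ⟦ q ⟧ m
⟦map⟧ a []      m = sym (ℕ.*-zeroʳ a)
⟦map⟧ a (b ∷ q) m = begin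
  a ℕ.* b ℕ.+ m ℕ.* ⟦ map (a ℕ.*_) q ⟧ m  ≡⟨ cong (λ t → a ℕ.* b ℕ.+ m ℕ.* t) (⟦map⟧ a q m) ⟩
  a ℕ.* b ℕ.+ m ℕ.* (a ℕ.* ⟦ q ⟧ m)       ≡⟨ factor a b m (⟦ q ⟧ m) ⟩
  a ℕ.* (b ℕ.+ m ℕ.* ⟦ q ⟧ m)             ∎
  where
  open ≡-Reasoning
  factor : ∀ a b m y → a ℕ.* b ℕ.+ m ℕ.* (a ℕ.* y) ≡ a ℕ.* (b ℕ.+ m ℕ.* y)
  factor = solve-∀

⟦*ₚ⟧ : ∀ p q m → ⟦ p *ₚ q ⟧ m ≡ ⟦ p ⟧ m ℕ.* ⟦ q ⟧ m
⟦*ₚ⟧ []      q m = refl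
⟦*ₚ⟧ (a ∷ p) q m = begin
  ⟦ map (a ℕ.*_) q +ₚ (0 ∷ p *ₚ q) ⟧ m             ≡⟨ ⟦+ₚ⟧ (map (a ℕ.*_) q) (0 ∷ p *ₚ q) m ⟩
  ⟦ map (a ℕ.*_) q ⟧ m ℕ.+ m ℕ.* ⟦ p *ₚ q ⟧ m      ≡⟨ cong₂ (λ s t → s ℕ.+ m ℕ.* t) (⟦map⟧ a q m) (⟦*ₚ⟧ p q m) ⟩
  a ℕ.* ⟦ q ⟧ m ℕ.+ m ℕ.* (⟦ p ⟧ m ℕ.* ⟦ q ⟧ m)   ≡⟨ factor a m (⟦ p ⟧ m) (⟦ q ⟧ m) ⟩
  (a ℕ.+ m ℕ.* ⟦ p ⟧ m) ℕ.* ⟦ q ⟧ m               ∎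
  where
  open ≡-Reasoning
  factor : ∀ a m x y → a ℕ.* y ℕ.+ m ℕ.* (x ℕ.* y) ≡ (a ℕ.+ m ℕ.* x) ℕ.* y
  factor = solve-∀

⟦X⟧ : ∀ m → ⟦ X ⟧ m ≡ m
⟦X⟧ m = trans (cong (λ t → m ℕ.* suc t) (ℕ.*-zeroʳ m)) (ℕ.*-identityʳ m)

⟦⟧-isHomomorphism : ∀ m → IsHomomorphism Poly-arith ℕ-arith (λ p → ⟦ p ⟧ m)
⟦⟧-isHomomorphism m = record
  { fromℕ-homo = λ n → trans (cong (n ℕ.+_) (ℕ.*-zeroʳ m)) (ℕ.+-identityʳ n)
  ; ⊕-homo     = λ p q → ⟦+ₚ⟧ p q m
  ; ⊗-homo     = λ p q → ⟦*ₚ⟧ p q m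
  }

infix 4 _≤ᶜ_

_≤ᶜ_ : Poly → Poly → Bool
[]      ≤ᶜ q       = true
(a ∷ p) ≤ᶜ []      = (a ℕ.≤ᵇ 0) ∧ (p ≤ᶜ [])
(a ∷ p) ≤ᶜ (b ∷ q) = (a ℕ.≤ᵇ b) ∧ (p ≤ᶜ q)

⟦⟧-mono-≤ᶜ : ∀ p q m → T (p ≤ᶜ q) → ⟦ p ⟧ m ≤ ⟦ q ⟧ m
⟦⟧-mono-≤ᶜ []      q       m _ = z≤n
⟦⟧-mono-≤ᶜ (a ∷ p) []      m h with Equivalence.to T-∧ h
... | a≤0 , p≤0 = ℕ.≤-trans (ℕ.+-mono-≤ (ℕ.≤ᵇ⇒≤ a 0 a≤0) (ℕ.*-monoʳ-≤ m (⟦⟧-mono-≤ᶜ p [] m p≤0)))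
                            (ℕ.≤-reflexive (ℕ.*-zeroʳ m))
⟦⟧-mono-≤ᶜ (a ∷ p) (b ∷ q) m h with Equivalence.to T-∧ h
... | a≤b , p≤q = ℕ.+-mono-≤ (ℕ.≤ᵇ⇒≤ a b a≤b) (ℕ.*-monoʳ-≤ m (⟦⟧-mono-≤ᶜ p q m p≤q))

<-by-coefficients : ∀ e f → T (eval Poly-arith (lit 1 +ₑ e) X ≤ᶜ eval Poly-arith f X) →
                    ∀ m → eval ℕ-arith e m ℕ.< eval ℕ-arith f m
<-by-coefficients e f check m =
  subst₂ _≤_ (expand (lit 1 +ₑ e)) (expand f)
         (⟦⟧-mono-≤ᶜ (eval Poly-arith (lit 1 +ₑ e) X) (eval Poly-arith f X) m check)
  where
  expand : ∀ e → ⟦ eval Poly-arith e X ⟧ m ≡ eval ℕ-arith e m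
  expand e = trans (eval-homo (⟦⟧-isHomomorphism m) e X) (cong (eval ℕ-arith e) (⟦X⟧ m))

ℕ→ℚᵘ : ℕ → ℚᵘ
ℕ→ℚᵘ n = mkℚᵘ (+ n) 0

toℚᵘ-ℕ→ℚ : ∀ n → toℚᵘ (ℕ→ℚ n) ≃ ℕ→ℚᵘ n
toℚᵘ-ℕ→ℚ n = toℚᵘ-fromℚᵘ (ℕ→ℚᵘ n)

ℕ→ℚᵘ-homo-+ : ∀ m n → ℕ→ℚᵘ (m ℕ.+ n) ≃ ℕ→ℚᵘ m ℚᵘ.+ ℕ→ℚᵘ n
ℕ→ℚᵘ-homo-+ m n = *≡* (cong (ℤ._* + 1)
  (trans (ℤ.pos-+ m n) (sym (cong₂ ℤ._+_ (ℤ.*-identityʳ (+ m)) (ℤ.*-identityʳ (+ n))))))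

ℕ→ℚᵘ-homo-* : ∀ m n → ℕ→ℚᵘ (m ℕ.* n) ≃ ℕ→ℚᵘ m ℚᵘ.* ℕ→ℚᵘ n
ℕ→ℚᵘ-homo-* m n = *≡* (cong (ℤ._* + 1) (ℤ.pos-* m n))

module _ where
  open import Relation.Binary.Reasoning.Setoid ℚᵘ.≃-setoid

  ℕ→ℚ-homo-+ : ∀ m n → ℕ→ℚ (m ℕ.+ n) ≡ ℕ→ℚ m + ℕ→ℚ n
  ℕ→ℚ-homo-+ m n = toℚᵘ-injective (begin
    toℚᵘ (ℕ→ℚ (m ℕ.+ n))            ≈⟨ toℚᵘ-ℕ→ℚ (m ℕ.+ n) ⟩
    ℕ→ℚᵘ (m ℕ.+ n)                   ≈⟨ ℕ→ℚᵘ-homo-+ m n ⟩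
    ℕ→ℚᵘ m ℚᵘ.+ ℕ→ℚᵘ n               ≈⟨ ℚᵘ.+-cong (toℚᵘ-ℕ→ℚ m) (toℚᵘ-ℕ→ℚ n) ⟨
    toℚᵘ (ℕ→ℚ m) ℚᵘ.+ toℚᵘ (ℕ→ℚ n)   ≈⟨ toℚᵘ-homo-+ (ℕ→ℚ m) (ℕ→ℚ n) ⟨
    toℚᵘ (ℕ→ℚ m + ℕ→ℚ n)             ∎)

  ℕ→ℚ-homo-* : ∀ m n → ℕ→ℚ (m ℕ.* n) ≡ ℕ→ℚ m * ℕ→ℚ n
  ℕ→ℚ-homo-* m n = toℚᵘ-injective (begin
    toℚᵘ (ℕ→ℚ (m ℕ.* n))            ≈⟨ toℚᵘ-ℕ→ℚ (m ℕ.* n) ⟩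
    ℕ→ℚᵘ (m ℕ.* n)                   ≈⟨ ℕ→ℚᵘ-homo-* m n ⟩
    ℕ→ℚᵘ m ℚᵘ.* ℕ→ℚᵘ n               ≈⟨ ℚᵘ.*-cong (toℚᵘ-ℕ→ℚ m) (toℚᵘ-ℕ→ℚ n) ⟨
    toℚᵘ (ℕ→ℚ m) ℚᵘ.* toℚᵘ (ℕ→ℚ n)   ≈⟨ toℚᵘ-homo-* (ℕ→ℚ m) (ℕ→ℚ n) ⟨
    toℚᵘ (ℕ→ℚ m * ℕ→ℚ n)             ∎)

ℕ→ℚ-mono-< : ∀ {m n} → m ℕ.< n → ℕ→ℚ m < ℕ→ℚ n
ℕ→ℚ-mono-< {m} {n} m<n = toℚᵘ-cancel-<
  (ℚᵘ.<-respˡ-≃ (ℚᵘ.≃-sym (toℚᵘ-ℕ→ℚ m)) (ℚᵘ.<-respʳ-≃ (ℚᵘ.≃-sym (toℚᵘ-ℕ→ℚ n))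
    (ℚᵘ.*<* (ℤ.*-monoʳ-<-pos (+ 1) (ℤ.+<+ m<n)))))

ℚ-arith : RawArith ℚ
ℚ-arith = record { fromℕ = ℕ→ℚ ; _⊕_ = _+_ ; _⊗_ = _*_ }

ℕ→ℚ-isHomomorphism : IsHomomorphism ℕ-arith ℚ-arith ℕ→ℚ
ℕ→ℚ-isHomomorphism = record
  { fromℕ-homo = λ _ → refl
  ; ⊕-homo     = ℕ→ℚ-homo-+
  ; ⊗-homo     = ℕ→ℚ-homo-*
  }

eval-ℕ→ℚ : ∀ e m → eval ℚ-arith e (ℕ→ℚ m) ≡ ℕ→ℚ (eval ℕ-arith e m)
eval-ℕ→ℚ e m = sym (eval-homo ℕ→ℚ-isHomomorphism e m)

eval-ℕ→ℚ-mono-< : ∀ e f m → eval ℕ-arith e m ℕ.< eval ℕ-arith f m →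
                  eval ℚ-arith e (ℕ→ℚ m) < eval ℚ-arith f (ℕ→ℚ m)
eval-ℕ→ℚ-mono-< e f m e<f = subst₂ _<_ (sym (eval-ℕ→ℚ e m)) (sym (eval-ℕ→ℚ f m)) (ℕ→ℚ-mono-< e<f)

*-positive : ∀ {p q} → 0ℚ < p → 0ℚ < q → 0ℚ < p * q
*-positive {p} {q} p>0 q>0 = ℚ.positive⁻¹ (p * q) {{ℚ.pos*pos⇒pos p {{positive p>0}} q {{positive q>0}}}}

inv-positive : ∀ {q} → 0ℚ < q → 0ℚ < inv q
inv-positive {q} q>0 with q ℚ.≟ 0ℚ
... | yes q≡0 = contradiction (sym q≡0) (ℚ.<⇒≢ q>0)
... | no  q≢0 = ℚ.positive⁻¹ _ {{ℚ.1/pos⇒pos q {{positive q>0}}}}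

inv-inverseʳ : ∀ {q} → 0ℚ < q → q * inv q ≡ 1ℚ
inv-inverseʳ {q} q>0 with q ℚ.≟ 0ℚ
... | yes q≡0 = contradiction (sym q≡0) (ℚ.<⇒≢ q>0)
... | no  q≢0 = ℚ.*-inverseʳ q {{ℚ.≢-nonZero q≢0}}

module _ {a b x y z : ℚ} (a>0 : 0ℚ < a) (b>0 : 0ℚ < b) (x>0 : 0ℚ < x) (y>0 : 0ℚ < y) (z>0 : 0ℚ < z) where
  open +-*-Solver

  private
    W : ℚ
    W = inv a * inv b * inv x * inv y * inv z

    instance
      W-positive : Positive W
      W-positive = positive (*-positive (*-positive (*-positive (*-positive
        (inv-positive a>0) (inv-positive b>0)) (inv-positive x>0)) (inv-positive y>0)) (inv-positive z>0))

    S : ℚ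
    S = inv x + inv y + inv z

    cancel : ∀ t {u v w s} → u ≡ 1ℚ → v ≡ 1ℚ → w ≡ 1ℚ → s ≡ 1ℚ → t * (u * (v * (w * s))) ≡ t
    cancel t refl refl refl refl = ℚ.*-identityʳ t

    b·xyz·W : b * (x * y * z) * W ≡ inv a
    b·xyz·W = trans (regroup b x y z (inv a) (inv b) (inv x) (inv y) (inv z))
      (cancel (inv a) (inv-inverseʳ b>0) (inv-inverseʳ x>0) (inv-inverseʳ y>0) (inv-inverseʳ z>0))
      where
      regroup : ∀ b x y z ia ib ix iy iz → b * (x * y * z) * (ia * ib * ix * iy * iz) ≡
                ia * ((b * ib) * ((x * ix) * ((y * iy) * (z * iz))))
      regroup = solve 9 (λ b x y z ia ib ix iy iz → b :* (x :* y :* z) :* (ia :* ib :* ix :* iy :* iz) :=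
                ia :* ((b :* ib) :* ((x :* ix) :* ((y :* iy) :* (z :* iz))))) refl

    a·xyz·W : a * (x * y * z) * W ≡ inv b
    a·xyz·W = trans (regroup a x y z (inv a) (inv b) (inv x) (inv y) (inv z))
      (cancel (inv b) (inv-inverseʳ a>0) (inv-inverseʳ x>0) (inv-inverseʳ y>0) (inv-inverseʳ z>0))
      where
      regroup : ∀ a x y z ia ib ix iy iz → a * (x * y * z) * (ia * ib * ix * iy * iz) ≡
                ib * ((a * ia) * ((x * ix) * ((y * iy) * (z * iz))))
      regroup = solve 9 (λ a x y z ia ib ix iy iz → a :* (x :* y :* z) :* (ia :* ib :* ix :* iy :* iz) :=
                ib :* ((a :* ia) :* ((x :* ix) :* ((y :* iy) :* (z :* iz))))) refl

    ab·σ·W : a * b * (y * z + x * z + x * y) * W ≡ S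
    ab·σ·W = trans (regroup a b x y z (inv a) (inv b) (inv x) (inv y) (inv z))
      (cong₂ _+_ (cong₂ _+_ (cancel (inv x) (inv-inverseʳ a>0) (inv-inverseʳ b>0) (inv-inverseʳ y>0) (inv-inverseʳ z>0))
                            (cancel (inv y) (inv-inverseʳ a>0) (inv-inverseʳ b>0) (inv-inverseʳ x>0) (inv-inverseʳ z>0)))
                 (cancel (inv z) (inv-inverseʳ a>0) (inv-inverseʳ b>0) (inv-inverseʳ x>0) (inv-inverseʳ y>0)))
      where
      regroup : ∀ a b x y z ia ib ix iy iz → a * b * (y * z + x * z + x * y) * (ia * ib * ix * iy * iz) ≡
                ix * ((a * ia) * ((b * ib) * ((y * iy) * (z * iz)))) +
                iy * ((a * ia) * ((b * ib) * ((x * ix) * (z * iz)))) +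
                iz * ((a * ia) * ((b * ib) * ((x * ix) * (y * iy))))
      regroup = solve 10 (λ a b x y z ia ib ix iy iz →
                a :* b :* (y :* z :+ x :* z :+ x :* y) :* (ia :* ib :* ix :* iy :* iz) :=
                ix :* ((a :* ia) :* ((b :* ib) :* ((y :* iy) :* (z :* iz)))) :+
                iy :* ((a :* ia) :* ((b :* ib) :* ((x :* ix) :* (z :* iz)))) :+
                iz :* ((a :* ia) :* ((b :* ib) :* ((x :* ix) :* (y :* iy))))) refl

    a·xyz+ab·σ·W : (a * (x * y * z) + a * b * (y * z + x * z + x * y)) * W ≡ inv b + S
    a·xyz+ab·σ·W = trans (ℚ.*-distribʳ-+ W (a * (x * y * z)) (a * b * (y * z + x * z + x * y)))
                         (cong₂ _+_ a·xyz·W ab·σ·W)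

  inv-gap<inv-sum : b * (x * y * z) < a * (x * y * z) + a * b * (y * z + x * z + x * y) →
                    inv a - inv b < inv x + inv y + inv z
  inv-gap<inv-sum gap<sum = subst (inv a - inv b <_) (xyx⁻¹≈y ℚ.+-0-abelianGroup (inv b) S)
                                  (ℚ.+-monoˡ-< (- inv b) 1/a<1/b+S)
    where
    1/a<1/b+S : inv a < inv b + S
    1/a<1/b+S = subst₂ _<_ b·xyz·W a·xyz+ab·σ·W (ℚ.*-monoˡ-<-pos W gap<sum)

  inv-sum<inv-gap : a * (x * y * z) + a * b * (y * z + x * z + x * y) < b * (x * y * z) →
                    inv x + inv y + inv z < inv a - inv b
  inv-sum<inv-gap sum<gap = subst (_< inv a - inv b) (//-rightDividesʳ ℚ.+-0-group (inv b) S)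
                                  (ℚ.+-monoˡ-< (- inv b) S+1/b<1/a)
    where
    S+1/b<1/a : S + inv b < inv a
    S+1/b<1/a = subst₂ _<_ (trans a·xyz+ab·σ·W (ℚ.+-comm (inv b) S)) b·xyz·W (ℚ.*-monoˡ-<-pos W sum<gap)

-- Multiplying 10/α − 10/β < 1/x + 1/y + 1/z through by αβxyz gives gap-side < sum-side.
module _ {A : Set} (O : RawArith A) where
  open RawArith O

  gap-side sum-side : A → A → A → A → A → A
  gap-side α β x y z = fromℕ 10 ⊗ β ⊗ (x ⊗ y ⊗ z)
  sum-side α β x y z = fromℕ 10 ⊗ α ⊗ (x ⊗ y ⊗ z) ⊕ α ⊗ β ⊗ (y ⊗ z ⊕ x ⊗ z ⊕ x ⊗ y)

tenth : ℚ
tenth = + 1 ℚ./ 10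

tenth>0 : 0ℚ < tenth
tenth>0 = ℚ.positive⁻¹ tenth

module _ {α β x y z : ℚ} (α>0 : 0ℚ < α) (β>0 : 0ℚ < β) (x>0 : 0ℚ < x) (y>0 : 0ℚ < y) (z>0 : 0ℚ < z) where
  open +-*-Solver

  private
    instance
      tenth²-positive : Positive (tenth * tenth)
      tenth²-positive = positive (*-positive tenth>0 tenth>0)

    gap-side-tenths : gap-side ℚ-arith α β x y z * (tenth * tenth) ≡ β * tenth * (x * y * z)
    gap-side-tenths = solve 4 (λ β x y z → con (ℕ→ℚ 10) :* β :* (x :* y :* z) :* (con tenth :* con tenth)
                                         := β :* con tenth :* (x :* y :* z)) refl β x y z

    sum-side-tenths : sum-side ℚ-arith α β x y z * (tenth * tenth) ≡
                      α * tenth * (x * y * z) + α * tenth * (β * tenth) * (y * z + x * z + x * y)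
    sum-side-tenths = solve 5 (λ α β x y z →
      (con (ℕ→ℚ 10) :* α :* (x :* y :* z) :+ α :* β :* (y :* z :+ x :* z :+ x :* y)) :* (con tenth :* con tenth)
      := α :* con tenth :* (x :* y :* z) :+ α :* con tenth :* (β :* con tenth) :* (y :* z :+ x :* z :+ x :* y))
      refl α β x y z

  inv-gap/10<inv-sum : gap-side ℚ-arith α β x y z < sum-side ℚ-arith α β x y z →
                       inv (α * tenth) - inv (β * tenth) < inv x + inv y + inv z
  inv-gap/10<inv-sum gap<sum = inv-gap<inv-sum (*-positive α>0 tenth>0) (*-positive β>0 tenth>0) x>0 y>0 z>0
    (subst₂ _<_ gap-side-tenths sum-side-tenths (ℚ.*-monoˡ-<-pos (tenth * tenth) gap<sum))

  inv-sum<inv-gap/10 : sum-side ℚ-arith α β x y z < gap-side ℚ-arith α β x y z →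
                       inv x + inv y + inv z < inv (α * tenth) - inv (β * tenth)
  inv-sum<inv-gap/10 sum<gap = inv-sum<inv-gap (*-positive α>0 tenth>0) (*-positive β>0 tenth>0) x>0 y>0 z>0
    (subst₂ _<_ sum-side-tenths gap-side-tenths (ℚ.*-monoˡ-<-pos (tenth * tenth) sum<gap))

p[2+x] : Poly
p[2+x] = 3759 ∷ 8096 ∷ 6564 ∷ 2376 ∷ 324 ∷ []

pℚ : ℚ → ℚ
pℚ K = ℕ→ℚ 324 * K ^ℚ 4 - ℕ→ℚ 216 * K ^ℚ 3 + ℕ→ℚ 84 * K ^ℚ 2 - ℕ→ℚ 16 * K - 1ℚ

module _ {A : Set} (O : RawArith A) where
  open RawArith O

  numerator : ℕ → A → A
  numerator c x = fromℕ c ⊕ fromℕ 10 ⊗ horner O p[2+x] x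

  fifth : ℕ → A → A
  fifth j x = pow O 5 (fromℕ j ⊕ fromℕ 3 ⊗ (fromℕ 2 ⊕ x))

  gap sum : ℕ → A → A
  gap c x = gap-side O (numerator c x) (numerator c (fromℕ 1 ⊕ x)) (fifth 0 x) (fifth 1 x) (fifth 2 x)
  sum c x = sum-side O (numerator c x) (numerator c (fromℕ 1 ⊕ x)) (fifth 0 x) (fifth 1 x) (fifth 2 x)

module _ where
  open +-*-Solver

  solver-arith : RawArith (Polynomial 1)
  solver-arith = record { fromℕ = λ n → con (ℕ→ℚ n) ; _⊕_ = _:+_ ; _⊗_ = _:*_ }

  pℚ-shift : ∀ M → pℚ (ℕ→ℚ 2 + M) ≡ horner ℚ-arith p[2+x] M
  pℚ-shift = solve 1 (λ M → let K = con (ℕ→ℚ 2) :+ M in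
    con (ℕ→ℚ 324) :* K :^ 4 :- con (ℕ→ℚ 216) :* K :^ 3 :+ con (ℕ→ℚ 84) :* K :^ 2 :- con (ℕ→ℚ 16) :* K :- con 1ℚ
    := horner solver-arith p[2+x] M) refl

  numerator-tenths : ∀ c n → numerator ℚ-arith c (ℕ→ℚ n) * tenth ≡ p (2 ℕ.+ n) + ℕ→ℚ c * tenth
  numerator-tenths c n = begin
    (ℕ→ℚ c + ℕ→ℚ 10 * horner ℚ-arith p[2+x] N) * tenth  ≡⟨ distribute (ℕ→ℚ c) (horner ℚ-arith p[2+x] N) ⟩
    horner ℚ-arith p[2+x] N + ℕ→ℚ c * tenth              ≡⟨ cong (_+ ℕ→ℚ c * tenth) (pℚ-shift N) ⟨
    pℚ (ℕ→ℚ 2 + N) + ℕ→ℚ c * tenth                       ≡⟨ cong (λ K → pℚ K + ℕ→ℚ c * tenth) (ℕ→ℚ-homo-+ 2 n) ⟨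
    p (2 ℕ.+ n) + ℕ→ℚ c * tenth                          ∎
    where
    open ≡-Reasoning
    N = ℕ→ℚ n
    distribute : ∀ C Q → (C + ℕ→ℚ 10 * Q) * tenth ≡ Q + C * tenth
    distribute = solve 2 (λ C Q → (C :+ con (ℕ→ℚ 10) :* Q) :* con tenth := Q :+ C :* con tenth) refl

-- Stated through eval: asking Agda to identify eval ℕ-arith (gap Expr-arith 9 var) m with
-- gap ℕ-arith 9 m would make it unfold ℕ multiplication in unary.
gap<sum : ∀ m → eval ℕ-arith (gap Expr-arith 9 var) m ℕ.< eval ℕ-arith (sum Expr-arith 9 var) m
gap<sum = <-by-coefficients (gap Expr-arith 9 var) (sum Expr-arith 9 var) _

sum<gap : ∀ m → eval ℕ-arith (sum Expr-arith 0 var) m ℕ.< eval ℕ-arith (gap Expr-arith 0 var) m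
sum<gap = <-by-coefficients (sum Expr-arith 0 var) (gap Expr-arith 0 var) _

reciprocal-fifths : ℕ → ℚ
reciprocal-fifths k =
  inv (ℕ→ℚ (3 ℕ.* k) ^ℚ 5) + inv (ℕ→ℚ (suc (3 ℕ.* k)) ^ℚ 5) + inv (ℕ→ℚ (suc (suc (3 ℕ.* k))) ^ℚ 5)

module _ (m : ℕ) where
  private
    M : ℚ
    M = ℕ→ℚ m

    eval-positive : ∀ e → 0 ℕ.< eval ℕ-arith e m → 0ℚ < eval ℚ-arith e M
    eval-positive e = eval-ℕ→ℚ-mono-< (lit 0) e m

    fifth-≡ : ∀ j → fifth ℚ-arith j M ≡ ℕ→ℚ (j ℕ.+ 3 ℕ.* (2 ℕ.+ m)) ^ℚ 5
    fifth-≡ j = cong (pow ℚ-arith 5) (eval-ℕ→ℚ (lit j +ₑ lit 3 *ₑ (lit 2 +ₑ var)) m)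

    inv-fifths-≡ : inv (fifth ℚ-arith 0 M) + inv (fifth ℚ-arith 1 M) + inv (fifth ℚ-arith 2 M) ≡
                   reciprocal-fifths (2 ℕ.+ m)
    inv-fifths-≡ = cong₂ _+_ (cong₂ (λ u v → inv u + inv v) (fifth-≡ 0) (fifth-≡ 1)) (cong inv (fifth-≡ 2))

    next-numerator-tenths : ∀ c → numerator ℚ-arith c (ℕ→ℚ 1 + M) * tenth ≡ p (3 ℕ.+ m) + ℕ→ℚ c * tenth
    next-numerator-tenths c =
      trans (cong (λ N → numerator ℚ-arith c N * tenth) (sym (ℕ→ℚ-homo-+ 1 m))) (numerator-tenths c (suc m))

    without-tenths : ∀ {q} r → q ≡ r + ℕ→ℚ 0 * tenth → q ≡ r
    without-tenths r q≡r = trans q≡r (ℚ.+-identityʳ r)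

  lower-bound : inv (p (2 ℕ.+ m) + nine-tenths) - inv (p (3 ℕ.+ m) + nine-tenths) < reciprocal-fifths (2 ℕ.+ m)
  lower-bound = subst₂ _<_ (cong₂ (λ u v → inv u - inv v) (numerator-tenths 9 m) (next-numerator-tenths 9))
                           inv-fifths-≡
    (inv-gap/10<inv-sum
      (eval-positive (numerator Expr-arith 9 var) z<s) (eval-positive (numerator Expr-arith 9 (lit 1 +ₑ var)) z<s)
      (eval-positive (fifth Expr-arith 0 var) z<s) (eval-positive (fifth Expr-arith 1 var) z<s)
      (eval-positive (fifth Expr-arith 2 var) z<s)
      (eval-ℕ→ℚ-mono-< (gap Expr-arith 9 var) (sum Expr-arith 9 var) m (gap<sum m)))

  upper-bound : reciprocal-fifths (2 ℕ.+ m) < inv (p (2 ℕ.+ m)) - inv (p (3 ℕ.+ m))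
  upper-bound = subst₂ _<_ inv-fifths-≡
    (cong₂ (λ u v → inv u - inv v) (without-tenths (p (2 ℕ.+ m)) (numerator-tenths 0 m))
                                   (without-tenths (p (3 ℕ.+ m)) (next-numerator-tenths 0)))
    (inv-sum<inv-gap/10
      (eval-positive (numerator Expr-arith 0 var) z<s) (eval-positive (numerator Expr-arith 0 (lit 1 +ₑ var)) z<s)
      (eval-positive (fifth Expr-arith 0 var) z<s) (eval-positive (fifth Expr-arith 1 var) z<s)
      (eval-positive (fifth Expr-arith 2 var) z<s)
      (eval-ℕ→ℚ-mono-< (sum Expr-arith 0 var) (gap Expr-arith 0 var) m (sum<gap m)))

lemma3p1 : (k : ℕ) → 2 ≤ k → ((inv (p k + nine-tenths) - inv (p (suc k) + nine-tenths)) < ((inv ((ℕ→ℚ (3 Data.Nat.* k)) ^ℚ 5) + inv ((ℕ→ℚ (suc (3 Data.Nat.* k))) ^ℚ 5)) + inv ((ℕ→ℚ (suc (suc (3 Data.Nat.* k)))) ^ℚ 5))) × (((inv ((ℕ→ℚ (3 Data.Nat.* k)) ^ℚ 5) + inv ((ℕ→ℚ (suc (3 Data.Nat.* k))) ^ℚ 5)) + inv ((ℕ→ℚ (suc (suc (3 Data.Nat.* k)))) ^ℚ 5)) < (inv (p k) - inv (p (suc k))))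
lemma3p1 (suc (suc m)) (s≤s (s≤s z≤n)) = lower-bound m , upper-bound m
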